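{- Let $\mathbf{S}_n$ be the set of permutations of $[n]$ and $\mathbf{I}_n$ the set of integer sequences $e=(e_1,\dots,e_n)$ with $0\le e_i<i$. Define $\phi:\mathbf{S}_n\to\mathbf{I}_n$ as follows: for $\pi=\pi_1\cdots\pi_n$, set $e_n=\pi_n-1$, and for $i=n-1,\dots,1$ (in this order): if $\pi_i\le i$ then $e_i=\pi_i-1$; otherwise, if $\pi_i$ is the $k$-th largest element of $\{\pi_1,\dots,\pi_i\}$, then $e_i$ is the $k$-th smallest element of the set $\{e_{i+1},\dots,e_n\}$; put $\phi(\pi)=(e_1,\dots,e_n)$. Then, for all $n$, $\phi$ maps the set of permutations $\pi\in\mathbf{S}_n$ having no entry $\pi_i$ such that at least two indices $a<i$ satisfy $\pi_a>\pi_i$ and at least two indices $b>i$ satisfy $\pi_b<\pi_i$, onto the set of $e\in\mathbf{I}_n$ for which there are no indices $i<j<k$ with $e_i>e_j$, $e_j\ne e_k$ and $e_i>e_k$.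
   Context: $\phi$ is a bijection from $\mathbf{S}_n$ to $\mathbf{I}_n$. The permutations described are those avoiding the quadrant marked mesh pattern $\mathrm{MMP}(0,2,0,2)$. -}

module Defs where

open import Data.Nat using (ℕ; zero; suc; _∸_; _≤_; _<_; _≤?_; _≟_)
open import Data.Nat.Properties using (≤-decTotalOrder)
open import Data.List using (List; []; _∷_; length; map; upTo; reverse; filter; deduplicate; lookup)
open import Data.List.Relation.Binary.Permutation.Propositional using (_↭_)
open import Data.List.Sort.InsertionSort.Base ≤-decTotalOrder using (sort)
open import Data.Fin as Fin using (Fin; toℕ)
open import Data.Product using (Σ; _×_; ∃-syntax)
open import Relation.Binary.PropositionalEquality using (_≡_)
open import Relation.Nullary using (¬_; yes; no)

IsPerm : ℕ → List ℕ → Set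
IsPerm n π = π ↭ map suc (upTo n)

-- Inversion sequences I_n : e = (e₁,…,eₙ) with 0 ≤ eᵢ < i  (1-indexed).
-- With 0-indexed position j (= i - 1), the condition eᵢ < i reads e_j ≤ j.
IsInvSeq : ℕ → List ℕ → Set
IsInvSeq n e = (length e ≡ n) × ((j : Fin (length e)) → lookup e j ≤ toℕ j)

-- k-th element (1-indexed) of a list, default 0 if out of range.
nth1 : ℕ → List ℕ → ℕ
nth1 k [] = 0
nth1 zero (x ∷ xs) = 0
nth1 (suc zero) (x ∷ xs) = x
nth1 (suc (suc k)) (x ∷ xs) = nth1 (suc k) xs

kthSmallest : ℕ → List ℕ → ℕ
kthSmallest k xs = nth1 k (sort (deduplicate _≟_ xs))

-- rank of x from the top in a list: x is the k-th largest of the set, k = #{y : y ≥ x}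
-- (the entries of a prefix of a permutation are distinct).
rankFromTop : ℕ → List ℕ → ℕ
rankFromTop x ys = length (deduplicate _≟_ (filter (x ≤?_) ys))

-- phiGo rpre acc : rpre = (πᵢ, πᵢ₋₁, …, π₁) (reversed prefix), acc = (eᵢ₊₁, …, eₙ).
-- Here i = length rpre.
phiGo : List ℕ → List ℕ → List ℕ
phiGo [] acc = acc
phiGo (x ∷ rest) acc with x ≤? suc (length rest)
... | yes _ = phiGo rest ((x ∸ 1) ∷ acc)
... | no  _ = phiGo rest (kthSmallest (rankFromTop x (x ∷ rest)) acc ∷ acc)

phi : List ℕ → List ℕ
phi π with reverse π
... | [] = []
... | x ∷ rest = phiGo rest ((x ∸ 1) ∷ [])

ContainsMMP0202 : List ℕ → Set
ContainsMMP0202 π =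
  ∃[ i ] ∃[ a₁ ] ∃[ a₂ ] ∃[ b₁ ] ∃[ b₂ ]
    (a₁ Fin.< a₂) × (a₂ Fin.< i) × (i Fin.< b₁) × (b₁ Fin.< b₂) ×
    (lookup π i < lookup π a₁) × (lookup π i < lookup π a₂) ×
    (lookup π b₁ < lookup π i) × (lookup π b₂ < lookup π i)

AvoidsMMP0202 : List ℕ → Set
AvoidsMMP0202 π = ¬ ContainsMMP0202 π

ContainsPatE : List ℕ → Set
ContainsPatE e =
  ∃[ i ] ∃[ j ] ∃[ k ]
    (i Fin.< j) × (j Fin.< k) ×
    (lookup e j < lookup e i) × (¬ (lookup e j ≡ lookup e k)) × (lookup e k < lookup e i)

AvoidsPatE : List ℕ → Set
AvoidsPatE e = ¬ ContainsPatE e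

-- φ reads π from right to left. When it reaches position p, the entries e_{p+1}, …, e_n computed so far
-- record which values ≤ p occur after position p: y < p is one of them iff y + 1 is one of π_{p+1}, …, π_n.
-- Counting the values ≤ p shows that as many entries after position p are ≤ p as entries up to p are > p.
-- For an avoider of MMP(0,2,0,2) this forces, when π_p > p, at most one larger entry before π_p, so e_p is
-- the smallest or second smallest later entry; and when π_p ≤ p, at most one smaller entry after π_p. In
-- both cases no two later entries lie below e_p, which is how φ(π) avoids the pattern. Conversely, reading
-- an avoiding e from right to left, π_p is e_p + 1 when that value is still unused and otherwise the largest
-- or second largest unused value, according as e_p is the smallest or second smallest later entry; the same
-- count shows that this rebuilds an avoider π with φ(π) = e.

module Submission where

open import Defs
open import Relation.Binary.PropositionalEquality
open import Data.Nat using (ℕ; zero; suc; _+_; _∸_; _≤_; _<_; _≤?_; _<?_; _≟_; z≤n; s≤s; s≤s⁻¹; s<s⁻¹)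
open import Data.Nat.Properties
open import Data.List using (List; []; _∷_; _++_; length; map; upTo; downFrom; reverse; filter; deduplicate; lookup)
open import Data.List.Properties
  using (length-++; length-map; length-downFrom; length-reverse; reverse-involutive; reverse-map; reverse-upTo;
         unfold-reverse; ++-assoc; ++-identityʳ; filter-++; filter-accept; filter-reject; filter-all; filter-none)
open import Data.List.Membership.Propositional using (_∈_; _∉_)
open import Data.List.Membership.Propositional.Properties
  using (∈-filter⁺; ∈-filter⁻; ∈-map⁺; ∈-map⁻; ∈-downFrom⁺; ∈-downFrom⁻; ∈-deduplicate⁺; ∈-deduplicate⁻;
         ∈-++⁻; ∈-++⁺ˡ; ∈-++⁺ʳ; ∈-lookup)
open import Data.List.Membership.DecPropositional _≟_ using (_∈?_)
open import Data.List.Relation.Unary.Any using (here; there; index)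
open import Data.List.Relation.Unary.Any.Properties using (lookup-index)
open import Data.List.Relation.Unary.All as All using (All; _∷_)
open import Data.List.Relation.Unary.All.Properties using (++⁻ˡ)
open import Data.List.Relation.Unary.AllPairs as AllPairs using (AllPairs; []; _∷_)
open import Data.List.Relation.Unary.Linked.Properties using (Linked⇒AllPairs)
open import Data.List.Relation.Unary.Unique.Propositional using (Unique)
import Data.List.Relation.Unary.Unique.Propositional.Properties as Unique
open import Data.List.Relation.Unary.Unique.DecPropositional.Properties _≟_ using (deduplicate-!)
open import Data.List.Relation.Binary.Permutation.Propositional
  using (_↭_; ↭-refl; ↭-sym; ↭-trans; ↭-prep; ↭-swap; ↭-reflexive; ↭⇒↭ₛ)
open import Data.List.Relation.Binary.Permutation.Propositional.Properties
  using (↭-length; filter-↭; shift; ↭-reverse; ++⁺ʳ; ∈-resp-↭)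
open import Data.List.Relation.Binary.Permutation.Setoid.Properties (setoid ℕ) using (Unique-resp-↭)
open import Data.List.Sort.InsertionSort.Base ≤-decTotalOrder using (sort)
open import Data.List.Sort.InsertionSort.Properties ≤-decTotalOrder using (sort-↭; sort-↗)
open import Data.List.Extrema ≤-totalOrder using (max; xs≤max; argmax-sel)
open import Data.Fin as Fin using (Fin; toℕ)
import Data.Fin.Properties as Fin
open import Data.Product using (_×_; _,_; proj₁; proj₂; ∃₂; ∃-syntax; uncurry)
open import Data.Sum using (_⊎_; inj₁; inj₂; [_,_]′)
open import Data.Empty using (⊥-elim)
open import Function using (_∘_; id)
open import Relation.Nullary using (¬_; yes; no; ¬?; contradiction)
open import Relation.Unary using (Decidable)
open import Relation.Binary.Definitions using (tri<; tri≈; tri>)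

≤⊎> : ∀ m n → m ≤ n ⊎ n < m
≤⊎> m n with m ≤? n
... | yes m≤n = inj₁ m≤n
... | no m≰n  = inj₂ (≰⇒> m≰n)

∈⇒1≤length : ∀ {A : Set} {w : A} {ys} → w ∈ ys → 1 ≤ length ys
∈⇒1≤length {ys = _ ∷ _} _ = s≤s z≤n

distinct⇒2≤length : ∀ {A : Set} {u v : A} {ys} → u ∈ ys → v ∈ ys → u ≢ v → 2 ≤ length ys
distinct⇒2≤length (here refl) (here refl) u≢v = contradiction refl u≢v
distinct⇒2≤length (here refl) (there v∈)  _   = s≤s (∈⇒1≤length v∈)
distinct⇒2≤length (there u∈)  (here refl) _   = s≤s (∈⇒1≤length u∈)
distinct⇒2≤length (there u∈)  (there v∈)  u≢v = m≤n⇒m≤1+n (distinct⇒2≤length u∈ v∈ u≢v)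

1≤length⇒∈ : ∀ {A : Set} {ys : List A} → 1 ≤ length ys → ∃[ w ] w ∈ ys
1≤length⇒∈ {ys = w ∷ _} _ = w , here refl

2≤length⇒distinct : ∀ {A : Set} {ys : List A} → Unique ys → 2 ≤ length ys →
  ∃₂ λ u v → u ∈ ys × v ∈ ys × u ≢ v
2≤length⇒distinct {ys = _ ∷ []}    _                 (s≤s ())
2≤length⇒distinct {ys = u ∷ v ∷ _} ((u≢v ∷ _) ∷ _) _ = u , v , here refl , there (here refl) , u≢v

Unique-∷⁻ : ∀ {A : Set} {x : A} {xs} → Unique (x ∷ xs) → x ∉ xs
Unique-∷⁻ (x≢xs ∷ _) x∈ = All.lookup x≢xs x∈ refl

Unique-++⁻ˡ : ∀ {A : Set} (xs : List A) {ys} → Unique (xs ++ ys) → Unique xs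
Unique-++⁻ˡ []       _          = []
Unique-++⁻ˡ (x ∷ xs) (x≢ ∷ xs!) = ++⁻ˡ xs x≢ ∷ Unique-++⁻ˡ xs xs!

Unique-++⁻ʳ : ∀ {A : Set} (xs : List A) {ys} → Unique (xs ++ ys) → Unique ys
Unique-++⁻ʳ []       xs!       = xs!
Unique-++⁻ʳ (x ∷ xs) (_ ∷ xs!) = Unique-++⁻ʳ xs xs!

Unique-↭ : ∀ {xs ys : List ℕ} → xs ↭ ys → Unique xs → Unique ys
Unique-↭ p = Unique-resp-↭ (↭⇒↭ₛ p)

deduplicate-unique : ∀ {xs} → Unique xs → deduplicate _≟_ xs ≡ xs
deduplicate-unique []                    = refl
deduplicate-unique {x ∷ xs} (x≢xs ∷ xs!) = cong (x ∷_) (begin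
  filter (¬? ∘ (x ≟_)) (deduplicate _≟_ xs) ≡⟨ cong (filter (¬? ∘ (x ≟_))) (deduplicate-unique xs!) ⟩
  filter (¬? ∘ (x ≟_)) xs                   ≡⟨ filter-all (¬? ∘ (x ≟_)) x≢xs ⟩
  xs                                        ∎)
  where open ≡-Reasoning

reverse-∷-++ : ∀ (x : ℕ) xs ys → reverse (x ∷ xs) ++ ys ≡ reverse xs ++ x ∷ ys
reverse-∷-++ x xs ys = trans (cong (_++ ys) (unfold-reverse x xs)) (++-assoc (reverse xs) (x ∷ []) ys)

module _ {A : Set} {P : A → Set} (P? : Decidable P) where

  count : List A → ℕ
  count xs = length (filter P? xs)

  count-↭ : ∀ {xs ys} → xs ↭ ys → count xs ≡ count ys
  count-↭ = ↭-length ∘ filter-↭ P?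

  count-++ : ∀ xs ys → count (xs ++ ys) ≡ count xs + count ys
  count-++ xs ys = trans (cong length (filter-++ P? xs ys)) (length-++ (filter P? xs))

  count-accept : ∀ {x xs} → P x → count (x ∷ xs) ≡ suc (count xs)
  count-accept = cong length ∘ filter-accept P?

  count-reject : ∀ {x xs} → ¬ P x → count (x ∷ xs) ≡ count xs
  count-reject = cong length ∘ filter-reject P?

  count-none : ∀ {xs} → (∀ {w} → w ∈ xs → ¬ P w) → count xs ≡ 0
  count-none none = cong length (filter-none P? (All.tabulate none))

  ∈⇒1≤count : ∀ {w xs} → w ∈ xs → P w → 1 ≤ count xs
  ∈⇒1≤count w∈ pw = ∈⇒1≤length (∈-filter⁺ P? w∈ pw)

  distinct⇒2≤count : ∀ {u v xs} → u ∈ xs → v ∈ xs → P u → P v → u ≢ v → 2 ≤ count xs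
  distinct⇒2≤count u∈ v∈ pu pv = distinct⇒2≤length (∈-filter⁺ P? u∈ pu) (∈-filter⁺ P? v∈ pv)

  1≤count⇒∈ : ∀ xs → 1 ≤ count xs → ∃[ w ] (w ∈ xs × P w)
  1≤count⇒∈ _ one = let (w , w∈) = 1≤length⇒∈ one in w , ∈-filter⁻ P? w∈

  2≤count⇒distinct : ∀ {xs} → Unique xs → 2 ≤ count xs →
    ∃₂ λ u v → u ∈ xs × v ∈ xs × P u × P v × u ≢ v
  2≤count⇒distinct xs! two =
    let (u , v , u∈ , v∈ , u≢v) = 2≤length⇒distinct (Unique.filter⁺ P? xs!) two
        (u∈xs , pu) = ∈-filter⁻ P? u∈
        (v∈xs , pv) = ∈-filter⁻ P? v∈
    in u , v , u∈xs , v∈xs , pu , pv , u≢v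

  1≤count⇒index : ∀ xs → 1 ≤ count xs → ∃[ a ] P (lookup xs a)
  1≤count⇒index xs one = let (w , w∈ , pw) = 1≤count⇒∈ xs one in index w∈ , subst P (lookup-index w∈) pw

  2≤count⇒pair : ∀ xs → 2 ≤ count xs → ∃₂ λ a b → a Fin.< b × P (lookup xs a) × P (lookup xs b)
  2≤count⇒pair (z ∷ zs) two with P? z
  ... | yes pz = let (b , pb) = 1≤count⇒index zs (s≤s⁻¹ two) in Fin.zero , Fin.suc b , s≤s z≤n , pz , pb
  ... | no _   = let (a , b , a<b , pa , pb) = 2≤count⇒pair zs two in Fin.suc a , Fin.suc b , s≤s a<b , pa , pb

  pair⇒2≤count : ∀ xs {a b} → a Fin.< b → P (lookup xs a) → P (lookup xs b) → 2 ≤ count xs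
  pair⇒2≤count (z ∷ zs) {Fin.zero} {Fin.suc b} _ pz pb with P? z
  ... | yes _  = s≤s (∈⇒1≤count (∈-lookup {xs = zs} b) pb)
  ... | no ¬pz = contradiction pz ¬pz
  pair⇒2≤count (z ∷ zs) {Fin.suc a} {Fin.suc b} (s≤s a<b) pa pb with P? z
  ... | yes _ = m≤n⇒m≤1+n (pair⇒2≤count zs a<b pa pb)
  ... | no _  = pair⇒2≤count zs a<b pa pb

module _ {A : Set} {P Q : A → Set} (P? : Decidable P) (Q? : Decidable Q) where

  count-mono : ∀ xs → (∀ {w} → w ∈ xs → P w → Q w) → count P? xs ≤ count Q? xs
  count-mono []       _   = z≤n
  count-mono (x ∷ xs) P⇒Q with P? x | Q? x
  ... | yes _  | yes _  = s≤s (count-mono xs (P⇒Q ∘ there))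
  ... | yes px | no ¬qx = contradiction (P⇒Q (here refl) px) ¬qx
  ... | no _   | yes _  = m≤n⇒m≤1+n (count-mono xs (P⇒Q ∘ there))
  ... | no _   | no _   = count-mono xs (P⇒Q ∘ there)

  count-partition : ∀ xs → (∀ {w} → ¬ P w → Q w) → (∀ {w} → P w → ¬ Q w) →
    count P? xs + count Q? xs ≡ length xs
  count-partition []       _      _      = refl
  count-partition (x ∷ xs) ¬P⇒Q P⇒¬Q with P? x | Q? x
  ... | yes px  | yes qx  = contradiction qx (P⇒¬Q px)
  ... | yes _   | no _    = cong suc (count-partition xs ¬P⇒Q P⇒¬Q)
  ... | no _    | yes _   = trans (+-suc _ _) (cong suc (count-partition xs ¬P⇒Q P⇒¬Q))
  ... | no ¬px  | no ¬qx  = contradiction (¬P⇒Q ¬px) ¬qx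

downFrom₁ : ℕ → List ℕ
downFrom₁ n = map suc (downFrom n)

∈-downFrom₁⁻ : ∀ {n w} → w ∈ downFrom₁ n → ∃[ v ] (w ≡ suc v × v < n)
∈-downFrom₁⁻ w∈ = let (v , v∈ , w≡) = ∈-map⁻ suc w∈ in v , w≡ , ∈-downFrom⁻ v∈

∈-downFrom₁⁺ : ∀ {n v} → v < n → suc v ∈ downFrom₁ n
∈-downFrom₁⁺ = ∈-map⁺ suc ∘ ∈-downFrom⁺

∈-downFrom₁⇒≤ : ∀ {n w} → w ∈ downFrom₁ n → w ≤ n
∈-downFrom₁⇒≤ w∈ with ∈-downFrom₁⁻ w∈
... | _ , refl , v<n = v<n

downFrom₁-unique : ∀ n → Unique (downFrom₁ n)
downFrom₁-unique n = Unique.map⁺ suc-injective (Unique.downFrom⁺ n)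

length-downFrom₁ : ∀ n → length (downFrom₁ n) ≡ n
length-downFrom₁ n = trans (length-map suc (downFrom n)) (length-downFrom n)

count-≤-downFrom₁ : ∀ {t} n → t ≤ n → count (_≤? t) (downFrom₁ n) ≡ t
count-≤-downFrom₁ zero t≤0 = sym (n≤0⇒n≡0 t≤0)
count-≤-downFrom₁ {t} (suc n) t≤1+n with t ≟ suc n
... | yes refl = trans (cong length (filter-all (_≤? suc n) (All.tabulate ∈-downFrom₁⇒≤))) (length-downFrom₁ (suc n))
... | no t≢1+n = trans (count-reject (_≤? t) (t≢1+n ∘ ≤-antisym t≤1+n))
                       (count-≤-downFrom₁ n (s≤s⁻¹ (≤∧≢⇒< t≤1+n t≢1+n)))

upTo↭downFrom₁ : ∀ n → map suc (upTo n) ↭ downFrom₁ n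
upTo↭downFrom₁ n = ↭-trans (↭-sym (↭-reverse (map suc (upTo n))))
  (↭-reflexive (trans (sym (reverse-map suc (upTo n))) (cong (map suc) (reverse-upTo n))))

↭downFrom₁⇒bounded : ∀ {n π} → π ↭ downFrom₁ n → ∀ {w} → w ∈ π → w ≤ length π
↭downFrom₁⇒bounded {n} perm w∈ =
  subst (_ ≤_) (sym (trans (↭-length perm) (length-downFrom₁ n))) (∈-downFrom₁⇒≤ (∈-resp-↭ perm w∈))

module Arrangement {n : ℕ} (R S : List ℕ) (perm : R ++ S ↭ downFrom₁ n) where

  unique : Unique (R ++ S)
  unique = Unique-↭ (↭-sym perm) (downFrom₁-unique n)

  unique-R : Unique R
  unique-R = Unique-++⁻ˡ R unique

  unique-S : Unique S
  unique-S = Unique-++⁻ʳ R unique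

  positive-S : ∀ {w} → w ∈ S → ∃[ v ] w ≡ suc v
  positive-S w∈ = let (v , w≡ , _) = ∈-downFrom₁⁻ (∈-resp-↭ perm (∈-++⁺ʳ R w∈)) in v , w≡

  positive-R : ∀ {w} → w ∈ R → ∃[ v ] w ≡ suc v
  positive-R w∈ = let (v , w≡ , _) = ∈-downFrom₁⁻ (∈-resp-↭ perm (∈-++⁺ˡ w∈)) in v , w≡

  length-R≤n : length R ≤ n
  length-R≤n = begin
    length R                 ≤⟨ m≤m+n (length R) (length S) ⟩
    length R + length S      ≡⟨ length-++ R ⟨
    length (R ++ S)          ≡⟨ ↭-length perm ⟩
    length (downFrom₁ n)     ≡⟨ length-downFrom₁ n ⟩
    n                        ∎
    where open ≤-Reasoning

  ∉R⇒∈S : ∀ {v} → v < length R → suc v ∉ R → suc v ∈ S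
  ∉R⇒∈S v< ∉R with ∈-++⁻ R (∈-resp-↭ (↭-sym perm) (∈-downFrom₁⁺ (<-≤-trans v< length-R≤n)))
  ... | inj₁ ∈R = contradiction ∈R ∉R
  ... | inj₂ ∈S = ∈S

  -- Both sides equal |R| minus the number of entries of R that are ≤ |R|.
  balance : count (length R <?_) R ≡ count (_≤? length R) S
  balance = +-cancelˡ-≡ (count (_≤? i) R) _ _ (trans split-R (sym split-all))
    where
    i : ℕ
    i = length R
    split-R : count (_≤? i) R + count (i <?_) R ≡ i
    split-R = count-partition (_≤? i) (i <?_) R ≰⇒> (λ w≤i i<w → <⇒≱ i<w w≤i)
    split-all : count (_≤? i) R + count (_≤? i) S ≡ i
    split-all = begin
      count (_≤? i) R + count (_≤? i) S  ≡⟨ count-++ (_≤? i) R S ⟨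
      count (_≤? i) (R ++ S)             ≡⟨ count-↭ (_≤? i) perm ⟩
      count (_≤? i) (downFrom₁ n)        ≡⟨ count-≤-downFrom₁ n length-R≤n ⟩
      i                                  ∎
      where open ≡-Reasoning

module _ {n x : ℕ} (rest S : List ℕ) (perm : (x ∷ rest) ++ S ↭ downFrom₁ n) where

  open Arrangement (x ∷ rest) S perm using (balance)

  smallerAfter≤largerBefore : x ≤ suc (length rest) → count (_<? x) S ≤ count (x <?_) rest
  smallerAfter≤largerBefore x≤p = begin
    count (_<? x) S          ≤⟨ count-mono (_<? x) (_≤? p) S (λ _ w<x → <⇒≤ (<-≤-trans w<x x≤p)) ⟩
    count (_≤? p) S          ≡⟨ balance ⟨
    count (p <?_) (x ∷ rest) ≡⟨ count-reject (p <?_) (≤⇒≯ x≤p) ⟩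
    count (p <?_) rest       ≤⟨ count-mono (p <?_) (x <?_) rest (λ _ → ≤-<-trans x≤p) ⟩
    count (x <?_) rest       ∎
    where
    p : ℕ
    p = suc (length rest)
    open ≤-Reasoning

  largerBefore<atMostAfter : suc (length rest) < x → suc (count (x <?_) rest) ≤ count (_≤? suc (length rest)) S
  largerBefore<atMostAfter p<x = begin
    suc (count (x <?_) rest) ≤⟨ s≤s (count-mono (x <?_) (p <?_) rest (λ _ → <-trans p<x)) ⟩
    suc (count (p <?_) rest) ≡⟨ count-accept (p <?_) p<x ⟨
    count (p <?_) (x ∷ rest) ≡⟨ balance ⟩
    count (_≤? p) S          ∎
    where
    p : ℕ
    p = suc (length rest)
    open ≤-Reasoning

-- The two smallest values of a list

TwoBelow : ℕ → List ℕ → Set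
TwoBelow y xs = ∃₂ λ u v → u ∈ xs × v ∈ xs × u < y × v < y × u ≢ v

TwoBelow-⊆ : ∀ {y xs ys} → (∀ {w} → w ∈ xs → w ∈ ys) → TwoBelow y xs → TwoBelow y ys
TwoBelow-⊆ xs⊆ys (u , v , u∈ , v∈ , below) = u , v , xs⊆ys u∈ , xs⊆ys v∈ , below

head≤ : ∀ {a t v} → AllPairs _<_ (a ∷ t) → v ∈ a ∷ t → a ≤ v
head≤ _          (here refl) = ≤-refl
head≤ (a<t ∷ _)  (there v∈) = <⇒≤ (All.lookup a<t v∈)

nth1-1 : ∀ {s w} → AllPairs _<_ s → w ∈ s → nth1 1 s ∈ s × nth1 1 s ≤ w × ¬ TwoBelow (nth1 1 s) s
nth1-1 {a ∷ t} s< w∈ = here refl , head≤ s< w∈ , λ (u , _ , u∈ , _ , u<a , _) → <⇒≱ u<a (head≤ s< u∈)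

nth1-2 : ∀ {s u v} → AllPairs _<_ s → u ∈ s → v ∈ s → u ≢ v →
  nth1 2 s ∈ s × (nth1 2 s ≤ u ⊎ nth1 2 s ≤ v) × ¬ TwoBelow (nth1 2 s) s
nth1-2 {_ ∷ []}    _ (here refl) (here refl) u≢v = contradiction refl u≢v
nth1-2 {_ ∷ []}    _ (here _)    (there ())  _
nth1-2 {_ ∷ []}    _ (there ())  _           _
nth1-2 {a ∷ b ∷ t} (_ ∷ b<) u∈ v∈ u≢v = there (here refl) , second u∈ v∈ u≢v , noTwo
  where
  second : ∀ {u v} → u ∈ a ∷ b ∷ t → v ∈ a ∷ b ∷ t → u ≢ v → b ≤ u ⊎ b ≤ v
  second (here refl) (here refl) u≢v = contradiction refl u≢v
  second (here refl) (there v∈)  _   = inj₂ (head≤ b< v∈)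
  second (there u∈)  _           _   = inj₁ (head≤ b< u∈)
  below-b⇒a : ∀ {w} → w ∈ a ∷ b ∷ t → w < b → w ≡ a
  below-b⇒a (here w≡a) _   = w≡a
  below-b⇒a (there w∈) w<b = contradiction (head≤ b< w∈) (<⇒≱ w<b)
  noTwo : ¬ TwoBelow b (a ∷ b ∷ t)
  noTwo (_ , _ , w₁∈ , w₂∈ , w₁<b , w₂<b , w₁≢w₂) = w₁≢w₂ (trans (below-b⇒a w₁∈ w₁<b) (sym (below-b⇒a w₂∈ w₂<b)))

nth1-≤2 : ∀ {s e} → AllPairs _<_ s → e ∈ s → ¬ TwoBelow e s → e ≡ nth1 1 s ⊎ e ≡ nth1 2 s
nth1-≤2 {_ ∷ _}     _ (here e≡a)          _ = inj₁ e≡a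
nth1-≤2 {_ ∷ []}    _ (there ())          _
nth1-≤2 {_ ∷ _ ∷ _} _ (there (here e≡b))  _ = inj₂ e≡b
nth1-≤2 {a ∷ b ∷ _} (a< ∷ b< ∷ _) (there (there e∈)) noTwo =
  contradiction (a , b , here refl , there (here refl) , <-trans a<b b<e , b<e , <⇒≢ a<b) noTwo
  where
  a<b : a < b
  a<b = All.lookup a< (here refl)
  b<e : b < _
  b<e = All.lookup b< e∈

sortedSet : List ℕ → List ℕ
sortedSet xs = sort (deduplicate _≟_ xs)

∈-sortedSet⁺ : ∀ {xs w} → w ∈ xs → w ∈ sortedSet xs
∈-sortedSet⁺ {xs} w∈ = ∈-resp-↭ (↭-sym (sort-↭ (deduplicate _≟_ xs))) (∈-deduplicate⁺ _≟_ w∈)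

∈-sortedSet⁻ : ∀ xs {w} → w ∈ sortedSet xs → w ∈ xs
∈-sortedSet⁻ xs w∈ = ∈-deduplicate⁻ _≟_ xs (∈-resp-↭ (sort-↭ (deduplicate _≟_ xs)) w∈)

sortedSet-strict : ∀ xs → AllPairs _<_ (sortedSet xs)
sortedSet-strict xs = AllPairs.zipWith (uncurry ≤∧≢⇒<)
  (Linked⇒AllPairs ≤-trans (sort-↗ (deduplicate _≟_ xs)) , Unique-↭ (↭-sym (sort-↭ (deduplicate _≟_ xs))) (deduplicate-! xs))

kthSmallest-1 : ∀ {xs w} → w ∈ xs →
  kthSmallest 1 xs ∈ xs × kthSmallest 1 xs ≤ w × ¬ TwoBelow (kthSmallest 1 xs) xs
kthSmallest-1 {xs} w∈ =
  let (k∈ , k≤w , noTwo) = nth1-1 (sortedSet-strict xs) (∈-sortedSet⁺ w∈)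
  in ∈-sortedSet⁻ xs k∈ , k≤w , noTwo ∘ TwoBelow-⊆ ∈-sortedSet⁺

kthSmallest-2 : ∀ {xs u v} → u ∈ xs → v ∈ xs → u ≢ v →
  kthSmallest 2 xs ∈ xs × (kthSmallest 2 xs ≤ u ⊎ kthSmallest 2 xs ≤ v) × ¬ TwoBelow (kthSmallest 2 xs) xs
kthSmallest-2 {xs} u∈ v∈ u≢v =
  let (k∈ , k≤ , noTwo) = nth1-2 (sortedSet-strict xs) (∈-sortedSet⁺ u∈) (∈-sortedSet⁺ v∈) u≢v
  in ∈-sortedSet⁻ xs k∈ , k≤ , noTwo ∘ TwoBelow-⊆ ∈-sortedSet⁺

¬TwoBelow⇒kthSmallest-1∨2 : ∀ {xs e} → e ∈ xs → ¬ TwoBelow e xs → e ≡ kthSmallest 1 xs ⊎ e ≡ kthSmallest 2 xs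
¬TwoBelow⇒kthSmallest-1∨2 {xs} e∈ noTwo =
  nth1-≤2 (sortedSet-strict xs) (∈-sortedSet⁺ e∈) (noTwo ∘ TwoBelow-⊆ (∈-sortedSet⁻ xs))

ContainsPatE-∷⁻ : ∀ {y xs} → ContainsPatE (y ∷ xs) → TwoBelow y xs ⊎ ContainsPatE xs
ContainsPatE-∷⁻ (Fin.zero   , Fin.zero   , _          , ()      , _)
ContainsPatE-∷⁻ (Fin.zero   , Fin.suc _  , Fin.zero   , _       , () , _)
ContainsPatE-∷⁻ (Fin.zero   , Fin.suc j  , Fin.suc k  , _       , _  , ej<y , ej≢ek , ek<y) =
  inj₁ (_ , _ , ∈-lookup j , ∈-lookup k , ej<y , ek<y , ej≢ek)
ContainsPatE-∷⁻ (Fin.suc _  , Fin.zero   , _          , ()      , _)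
ContainsPatE-∷⁻ (Fin.suc _  , Fin.suc _  , Fin.zero   , _       , () , _)
ContainsPatE-∷⁻ (Fin.suc i  , Fin.suc j  , Fin.suc k  , s≤s i<j , s≤s j<k , values) =
  inj₂ (i , j , k , i<j , j<k , values)

TwoBelow-ordered⇒ContainsPatE : ∀ {y xs u v} (u∈ : u ∈ xs) (v∈ : v ∈ xs) → index u∈ Fin.< index v∈ →
  u < y → v < y → u ≢ v → ContainsPatE (y ∷ xs)
TwoBelow-ordered⇒ContainsPatE u∈ v∈ j<k u<y v<y u≢v =
  Fin.zero , Fin.suc (index u∈) , Fin.suc (index v∈) , s≤s z≤n , s≤s j<k ,
  subst (_< _) (lookup-index u∈) u<y ,
  (λ eq → u≢v (trans (lookup-index u∈) (trans eq (sym (lookup-index v∈))))) ,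
  subst (_< _) (lookup-index v∈) v<y

TwoBelow⇒ContainsPatE : ∀ {y xs} → TwoBelow y xs → ContainsPatE (y ∷ xs)
TwoBelow⇒ContainsPatE {xs = xs} (_ , _ , u∈ , v∈ , u<y , v<y , u≢v) with Fin.<-cmp (index u∈) (index v∈)
... | tri< j<k _ _ = TwoBelow-ordered⇒ContainsPatE u∈ v∈ j<k u<y v<y u≢v
... | tri≈ _ j≡k _ = contradiction (trans (lookup-index u∈) (trans (cong (lookup xs) j≡k) (sym (lookup-index v∈)))) u≢v
... | tri> _ _ k<j = TwoBelow-ordered⇒ContainsPatE v∈ u∈ k<j v<y u<y (u≢v ∘ sym)

ContainsPatE-++⁺ : ∀ xs {ys} → ContainsPatE ys → ContainsPatE (xs ++ ys)
ContainsPatE-++⁺ []       c = c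
ContainsPatE-++⁺ (_ ∷ xs) c with ContainsPatE-++⁺ xs c
... | i , j , k , i<j , j<k , values = Fin.suc i , Fin.suc j , Fin.suc k , s≤s i<j , s≤s j<k , values

AvoidsPatE-∷ : ∀ {y xs} → ¬ TwoBelow y xs → AvoidsPatE xs → AvoidsPatE (y ∷ xs)
AvoidsPatE-∷ noTwo avoids = [ noTwo , avoids ]′ ∘ ContainsPatE-∷⁻

AvoidsPatE⇒¬TwoBelow : ∀ xs {y ys} → AvoidsPatE (xs ++ y ∷ ys) → ¬ TwoBelow y ys
AvoidsPatE⇒¬TwoBelow xs avoids = avoids ∘ ContainsPatE-++⁺ xs ∘ TwoBelow⇒ContainsPatE

-- xs is what remains of an inversion sequence after its first k entries.
InvTail : ℕ → List ℕ → Set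
InvTail k xs = ∀ j → lookup xs j ≤ k + toℕ j

InvTail-∷ : ∀ {k y xs} → y ≤ k → InvTail (suc k) xs → InvTail k (y ∷ xs)
InvTail-∷ {y = y} y≤k _ Fin.zero = subst (y ≤_) (sym (+-identityʳ _)) y≤k
InvTail-∷ {k} {xs = xs} _ bounded (Fin.suc j) = subst (lookup xs j ≤_) (sym (+-suc k (toℕ j))) (bounded j)

InvTail-tail : ∀ {k x xs} → InvTail k (x ∷ xs) → InvTail (suc k) xs
InvTail-tail {k} {xs = xs} bounded j = subst (lookup xs j ≤_) (+-suc k (toℕ j)) (bounded (Fin.suc j))

InvTail-++⇒≤ : ∀ {k} xs {y ys} → InvTail k (xs ++ y ∷ ys) → y ≤ k + length xs
InvTail-++⇒≤ []           bounded = bounded Fin.zero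
InvTail-++⇒≤ {k} (_ ∷ xs) {y} bounded = subst (y ≤_) (sym (+-suc k (length xs))) (InvTail-++⇒≤ xs (InvTail-tail bounded))

-- The mesh pattern MMP(0,2,0,2)

module _ {A : Set} where

  inject-++ : ∀ (xs ys : List A) a → ∃[ a' ] (toℕ a' ≡ toℕ a × lookup (xs ++ ys) a' ≡ lookup xs a)
  inject-++ (x ∷ xs) ys Fin.zero    = Fin.zero , refl , refl
  inject-++ (x ∷ xs) ys (Fin.suc a) = let (a' , e , l) = inject-++ xs ys a in Fin.suc a' , cong suc e , l

  raise-++ : ∀ (xs ys : List A) b → ∃[ b' ] (toℕ b' ≡ length xs + toℕ b × lookup (xs ++ ys) b' ≡ lookup ys b)
  raise-++ []       ys b = b , refl , refl
  raise-++ (x ∷ xs) ys b = let (b' , e , l) = raise-++ xs ys b in Fin.suc b' , cong suc e , l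

  restrict-++ˡ : ∀ (xs ys : List A) a → toℕ a < length xs →
    ∃[ a' ] (toℕ a' ≡ toℕ a × lookup xs a' ≡ lookup (xs ++ ys) a)
  restrict-++ˡ []       ys a           ()
  restrict-++ˡ (x ∷ xs) ys Fin.zero    _  = Fin.zero , refl , refl
  restrict-++ˡ (x ∷ xs) ys (Fin.suc a) a< =
    let (a' , e , l) = restrict-++ˡ xs ys a (s<s⁻¹ a<) in Fin.suc a' , cong suc e , l

  restrict-++ʳ : ∀ (xs ys : List A) b → length xs ≤ toℕ b →
    ∃[ b' ] (length xs + toℕ b' ≡ toℕ b × lookup ys b' ≡ lookup (xs ++ ys) b)
  restrict-++ʳ []       ys b           _   = b , refl , refl
  restrict-++ʳ (x ∷ xs) ys Fin.zero    ()
  restrict-++ʳ (x ∷ xs) ys (Fin.suc b) xs≤ =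
    let (b' , e , l) = restrict-++ʳ xs ys b (s≤s⁻¹ xs≤) in b' , cong suc e , l

  splitAt-index : ∀ (xs : List A) i →
    ∃[ pre ] ∃[ x ] ∃[ suf ] (xs ≡ pre ++ x ∷ suf × length pre ≡ toℕ i × lookup xs i ≡ x)
  splitAt-index (y ∷ ys) Fin.zero    = [] , y , ys , refl , refl , refl
  splitAt-index (y ∷ ys) (Fin.suc i) =
    let (pre , x , suf , eq , |pre| , lk) = splitAt-index ys i
    in y ∷ pre , x , suf , cong (y ∷_) eq , cong suc |pre| , lk

<-via-toℕ : ∀ {k m n} {i j : Fin k} → toℕ i ≡ m → toℕ j ≡ n → m < n → i Fin.< j
<-via-toℕ refl refl m<n = m<n

record MMPAt (before : List ℕ) (x : ℕ) (after : List ℕ) : Set where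
  constructor mmpAt
  field
    largerBefore : 2 ≤ count (x <?_) before
    smallerAfter : 2 ≤ count (_<? x) after

MMPAt-↭ : ∀ {xs ys x S} → xs ↭ ys → MMPAt xs x S → MMPAt ys x S
MMPAt-↭ {x = x} p (mmpAt before after) = mmpAt (subst (2 ≤_) (count-↭ (x <?_) p) before) after

-- No occurrence of the pattern is centred in S, the entries R preceding S being given in any order.
MMPFreeAfter : List ℕ → List ℕ → Set
MMPFreeAfter R S = ∀ pre x suf → S ≡ pre ++ x ∷ suf → ¬ MMPAt (R ++ pre) x suf

split⇒ContainsMMP : ∀ {pre x suf} → MMPAt pre x suf → ContainsMMP0202 (pre ++ x ∷ suf)
split⇒ContainsMMP {pre} {x} {suf} (mmpAt before after)
  with 2≤count⇒pair (x <?_) pre before | 2≤count⇒pair (_<? x) suf after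
... | a₁ , a₂ , a₁<a₂ , v₁ , v₂ | b₁ , b₂ , b₁<b₂ , v₃ , v₄
  with inject-++ pre (x ∷ suf) a₁ | inject-++ pre (x ∷ suf) a₂ | raise-++ pre (x ∷ suf) Fin.zero
     | raise-++ pre (x ∷ suf) (Fin.suc b₁) | raise-++ pre (x ∷ suf) (Fin.suc b₂)
... | A₁ , eA₁ , lA₁ | A₂ , eA₂ , lA₂ | I , eI , lI | B₁ , eB₁ , lB₁ | B₂ , eB₂ , lB₂ =
  I , A₁ , A₂ , B₁ , B₂ ,
  <-via-toℕ eA₁ eA₂ a₁<a₂ ,
  <-via-toℕ eA₂ eI (subst (toℕ a₂ <_) (sym (+-identityʳ _)) (Fin.toℕ<n a₂)) ,
  <-via-toℕ eI eB₁ (+-monoʳ-< (length pre) (s≤s z≤n)) ,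
  <-via-toℕ eB₁ eB₂ (+-monoʳ-< (length pre) (s≤s b₁<b₂)) ,
  subst₂ _<_ (sym lI) (sym lA₁) v₁ , subst₂ _<_ (sym lI) (sym lA₂) v₂ ,
  subst₂ _<_ (sym lB₁) (sym lI) v₃ , subst₂ _<_ (sym lB₂) (sym lI) v₄

ContainsMMP⇒split : ∀ π → ContainsMMP0202 π → ∃[ pre ] ∃[ x ] ∃[ suf ] (π ≡ pre ++ x ∷ suf × MMPAt pre x suf)
ContainsMMP⇒split π (i , a₁ , a₂ , b₁ , b₂ , a₁<a₂ , a₂<i , i<b₁ , b₁<b₂ , v₁ , v₂ , v₃ , v₄)
  with splitAt-index π i
... | pre , x , suf , refl , |pre| , πᵢ≡x = pre , x , suf , refl , mmpAt before after
  where
  a₂<|pre| : toℕ a₂ < length pre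
  a₂<|pre| = subst (toℕ a₂ <_) (sym |pre|) a₂<i
  |pre|<b₁ : length pre < toℕ b₁
  |pre|<b₁ = subst (_< toℕ b₁) (sym |pre|) i<b₁
  before : 2 ≤ count (x <?_) pre
  before with restrict-++ˡ pre (x ∷ suf) a₁ (<-trans a₁<a₂ a₂<|pre|) | restrict-++ˡ pre (x ∷ suf) a₂ a₂<|pre|
  ... | a₁' , e₁ , l₁ | a₂' , e₂ , l₂ =
    pair⇒2≤count (x <?_) pre (<-via-toℕ e₁ e₂ a₁<a₂) (subst₂ _<_ πᵢ≡x (sym l₁) v₁) (subst₂ _<_ πᵢ≡x (sym l₂) v₂)
  -- the entry x itself is not below x, so pairs may be looked for in x ∷ suf
  after : 2 ≤ count (_<? x) suf
  after with restrict-++ʳ pre (x ∷ suf) b₁ (<⇒≤ |pre|<b₁) | restrict-++ʳ pre (x ∷ suf) b₂ (<⇒≤ (<-trans |pre|<b₁ b₁<b₂))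
  ... | b₁' , e₁ , l₁ | b₂' , e₂ , l₂ =
    subst (2 ≤_) (count-reject (_<? x) (<-irrefl refl))
      (pair⇒2≤count (_<? x) (x ∷ suf) (+-cancelˡ-< (length pre) _ _ (subst₂ _<_ (sym e₁) (sym e₂) b₁<b₂))
        (subst₂ _<_ (sym l₁) πᵢ≡x v₃) (subst₂ _<_ (sym l₂) πᵢ≡x v₄))

AvoidsMMP⇒MMPFree : ∀ {π} → AvoidsMMP0202 π → MMPFreeAfter [] π
AvoidsMMP⇒MMPFree avoids _ _ _ refl = avoids ∘ split⇒ContainsMMP

MMPFree⇒AvoidsMMP : ∀ {π} → MMPFreeAfter [] π → AvoidsMMP0202 π
MMPFree⇒AvoidsMMP {π} free c = let (pre , x , suf , eq , mmp) = ContainsMMP⇒split π c in free pre x suf eq mmp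

MMPFreeAfter-∷ : ∀ {R R' c S} → R ↭ c ∷ R' → MMPFreeAfter R S → ¬ MMPAt R' c S → MMPFreeAfter R' (c ∷ S)
MMPFreeAfter-∷ _ _ local [] _ _ refl = local ∘ MMPAt-↭ (↭-reflexive (++-identityʳ _))
MMPFreeAfter-∷ {R} {R'} {c} R↭ free _ (_ ∷ pre) x suf refl =
  free pre x suf refl ∘ MMPAt-↭ (↭-trans (shift c R' pre) (++⁺ʳ pre (↭-sym R↭)))

nextEntry : ℕ → List ℕ → List ℕ → ℕ
nextEntry x rest acc with x ≤? suc (length rest)
... | yes _ = x ∸ 1
... | no _  = kthSmallest (rankFromTop x (x ∷ rest)) acc

phiGo-∷ : ∀ x rest acc → phiGo (x ∷ rest) acc ≡ phiGo rest (nextEntry x rest acc ∷ acc)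
phiGo-∷ x rest acc with x ≤? suc (length rest)
... | yes _ = refl
... | no _  = refl

length-phiGo : ∀ rpre acc → length (phiGo rpre acc) ≡ length rpre + length acc
length-phiGo []         _   = refl
length-phiGo (x ∷ rest) acc rewrite phiGo-∷ x rest acc = trans (length-phiGo rest _) (+-suc _ _)

nextEntry-small : ∀ {x rest} acc → x ≤ suc (length rest) → nextEntry x rest acc ≡ x ∸ 1
nextEntry-small {x} {rest} _ x≤p with x ≤? suc (length rest)
... | yes _   = refl
... | no x≰p  = contradiction x≤p x≰p

rankFromTop-head : ∀ {x rest} → Unique (x ∷ rest) → rankFromTop x (x ∷ rest) ≡ suc (count (x <?_) rest)
rankFromTop-head {x} {rest} x∷rest! = begin
  length (deduplicate _≟_ (filter (x ≤?_) (x ∷ rest))) ≡⟨ cong length (deduplicate-unique (Unique.filter⁺ (x ≤?_) x∷rest!)) ⟩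
  count (x ≤?_) (x ∷ rest)                             ≡⟨ count-accept (x ≤?_) ≤-refl ⟩
  suc (count (x ≤?_) rest)                             ≡⟨ cong suc (≤-antisym (count-mono (x ≤?_) (x <?_) rest ≤⇒<)
                                                                               (count-mono (x <?_) (x ≤?_) rest (λ _ → <⇒≤))) ⟩
  suc (count (x <?_) rest)                             ∎
  where
  open ≡-Reasoning
  ≤⇒< : ∀ {w} → w ∈ rest → x ≤ w → x < w
  ≤⇒< w∈ x≤w = ≤∧≢⇒< x≤w (λ x≡w → Unique-∷⁻ x∷rest! (subst (_∈ rest) (sym x≡w) w∈))

nextEntry-large : ∀ {x rest} acc → suc (length rest) < x → Unique (x ∷ rest) →
  nextEntry x rest acc ≡ kthSmallest (suc (count (x <?_) rest)) acc
nextEntry-large {x} {rest} acc p<x x∷rest! with x ≤? suc (length rest)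
... | yes x≤p = contradiction x≤p (<⇒≱ p<x)
... | no _    = cong (λ k → kthSmallest k acc) (rankFromTop-head x∷rest!)

phi≡phiGo : ∀ π → (∀ {w} → w ∈ π → w ≤ length π) → phi π ≡ phiGo (reverse π) []
phi≡phiGo π bounded with reverse π in eq
... | []       = refl
... | x ∷ rest = sym (trans (phiGo-∷ x rest []) (cong (λ y → phiGo rest (y ∷ [])) (nextEntry-small [] x≤p)))
  where
  x≤p : x ≤ suc (length rest)
  x≤p = subst (x ≤_) (trans (sym (length-reverse π)) (cong length eq))
              (bounded (∈-resp-↭ (↭-reverse π) (subst (x ∈_) (sym eq) (here refl))))

-- acc lists e_{p+1}, …, e_n and S lists π_{p+1}, …, π_n.
Tracks : ℕ → List ℕ → List ℕ → Set
Tracks p acc S = ∀ {y} → y < p → (y ∈ acc → suc y ∈ S) × (suc y ∈ S → y ∈ acc)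

tracks-[] : ∀ {p} → Tracks p [] []
tracks-[] _ = (λ ()) , (λ ())

EntryMatch : ℕ → ℕ → ℕ → List ℕ → Set
EntryMatch p x y S = x ≡ suc y ⊎ (p < x × suc y ∈ S)

tracks-∷ : ∀ {i acc S x y} → Tracks (suc i) acc S → EntryMatch (suc i) x y S → Tracks i (y ∷ acc) (x ∷ S)
tracks-∷ {i} {acc} {S} {x} {y} tr match {z} z<i = to , from
  where
  z<1+i : z < suc i
  z<1+i = m<n⇒m<1+n z<i
  suc-y∈ : suc y ∈ x ∷ S
  suc-y∈ = [ here ∘ sym , there ∘ proj₂ ]′ match
  to : z ∈ y ∷ acc → suc z ∈ x ∷ S
  to (here z≡y) = subst (λ t → suc t ∈ x ∷ S) (sym z≡y) suc-y∈
  to (there z∈) = there (proj₁ (tr z<1+i) z∈)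
  from : suc z ∈ x ∷ S → z ∈ y ∷ acc
  from (here 1+z≡x) = [ (λ x≡1+y → here (suc-injective (trans 1+z≡x x≡1+y)))
                      , (λ (p<x , _) → ⊥-elim (<-asym z<i (s<s⁻¹ (subst (suc i <_) (sym 1+z≡x) p<x)))) ]′ match
  from (there 1+z∈) = there (proj₂ (tr z<1+i) 1+z∈)

module Tracking {n p : ℕ} (R S : List ℕ) {acc : List ℕ} (perm : R ++ S ↭ downFrom₁ n) (tr : Tracks p acc S) where

  open Arrangement R S perm

  TwoBelow⇒2≤count : ∀ {y} → y < p → TwoBelow y acc → 2 ≤ count (_<? suc y) S
  TwoBelow⇒2≤count {y} y<p (_ , _ , u∈ , v∈ , u<y , v<y , u≢v) =
    distinct⇒2≤count (_<? suc y) (proj₁ (tr (<-trans u<y y<p)) u∈) (proj₁ (tr (<-trans v<y y<p)) v∈)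
      (s≤s u<y) (s≤s v<y) (u≢v ∘ suc-injective)

  ≤p-in-S⇒∈acc : ∀ {w} → w ∈ S → w ≤ p → ∃[ z ] (w ≡ suc z × z ∈ acc)
  ≤p-in-S⇒∈acc w∈ w≤p with positive-S w∈
  ... | z , refl = z , refl , proj₂ (tr w≤p) w∈

  1≤count⇒∈acc : ∀ {q} → q ≤ p → 1 ≤ count (_≤? q) S → ∃[ z ] (z ∈ acc × z < q)
  1≤count⇒∈acc {q} q≤p one with 1≤count⇒∈ (_≤? q) S one
  ... | w , w∈ , w≤q with ≤p-in-S⇒∈acc w∈ (≤-trans w≤q q≤p)
  ...   | z , refl , z∈ = z , z∈ , w≤q

  2≤count⇒TwoBelow : ∀ {q} → q ≤ p → 2 ≤ count (_≤? q) S → TwoBelow q acc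
  2≤count⇒TwoBelow {q} q≤p two with 2≤count⇒distinct (_≤? q) unique-S two
  ... | w₁ , w₂ , w₁∈ , w₂∈ , w₁≤q , w₂≤q , w₁≢w₂
    with ≤p-in-S⇒∈acc w₁∈ (≤-trans w₁≤q q≤p) | ≤p-in-S⇒∈acc w₂∈ (≤-trans w₂≤q q≤p)
  ... | z₁ , refl , z₁∈ | z₂ , refl , z₂∈ = z₁ , z₂ , z₁∈ , z₂∈ , w₁≤q , w₂≤q , w₁≢w₂ ∘ cong suc

-- φ sends avoiders of MMP(0,2,0,2) to avoiders of the pattern

Admissible : ℕ → List ℕ → List ℕ → ℕ → ℕ → Set
Admissible p acc S x y = y < p × ¬ TwoBelow y acc × EntryMatch p x y S

admissible-small : ∀ {n x} rest S {acc} → (x ∷ rest) ++ S ↭ downFrom₁ n → Tracks (suc (length rest)) acc S →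
  ¬ MMPAt rest x S → x ≤ suc (length rest) → Admissible (suc (length rest)) acc S x (nextEntry x rest acc)
admissible-small rest S {acc} perm tr noMMP x≤p with Arrangement.positive-R (_ ∷ rest) S perm (here refl)
... | v , refl rewrite nextEntry-small {suc v} {rest} acc x≤p = x≤p , noTwo , inj₁ refl
  where
  noTwo : ¬ TwoBelow v acc
  noTwo two = noMMP (mmpAt (≤-trans after (smallerAfter≤largerBefore rest S perm x≤p)) after)
    where
    after : 2 ≤ count (_<? suc v) S
    after = Tracking.TwoBelow⇒2≤count (suc v ∷ rest) S perm tr x≤p two

module _ {n x : ℕ} (rest S : List ℕ) {acc : List ℕ} (perm : (x ∷ rest) ++ S ↭ downFrom₁ n)
         (tr : Tracks (suc (length rest)) acc S) (noMMP : ¬ MMPAt rest x S) where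

  open Arrangement (x ∷ rest) S perm using (unique-R)
  open Tracking (x ∷ rest) S perm tr

  private
    p : ℕ
    p = suc (length rest)

  admissible-fromAcc : ∀ {y} → p < x → y ∈ acc → y < p → ¬ TwoBelow y acc → Admissible p acc S x y
  admissible-fromAcc p<x y∈ y<p noTwo = y<p , noTwo , inj₂ (p<x , proj₁ (tr y<p) y∈)

  -- The rank k of x is 1 + #{larger entries before x}; at least k entries ≤ p follow x, so k ≥ 3 yields the pattern.
  admissible-large : p < x → Admissible p acc S x (nextEntry x rest acc)
  admissible-large p<x rewrite nextEntry-large acc p<x unique-R
    with count (x <?_) rest in larger | largerBefore<atMostAfter rest S perm p<x
  ... | 0 | one =
    let (z , z∈ , z<p) = 1≤count⇒∈acc ≤-refl one
        (k∈ , k≤z , noTwo) = kthSmallest-1 z∈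
    in admissible-fromAcc p<x k∈ (≤-<-trans k≤z z<p) noTwo
  ... | 1 | two =
    let (z₁ , z₂ , z₁∈ , z₂∈ , z₁<p , z₂<p , z₁≢z₂) = 2≤count⇒TwoBelow ≤-refl two
        (k∈ , k≤z₁∨z₂ , noTwo) = kthSmallest-2 z₁∈ z₂∈ z₁≢z₂
    in admissible-fromAcc p<x k∈ ([ (λ k≤z₁ → ≤-<-trans k≤z₁ z₁<p) , (λ k≤z₂ → ≤-<-trans k≤z₂ z₂<p) ]′ k≤z₁∨z₂) noTwo
  ... | suc (suc _) | atLeast3 = contradiction
    (mmpAt (subst (2 ≤_) (sym larger) (s≤s (s≤s z≤n)))
           (≤-trans (≤-trans (s≤s (s≤s z≤n)) atLeast3) (count-mono (_≤? p) (_<? x) S (λ _ w≤p → ≤-<-trans w≤p p<x))))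
    noMMP

nextEntry-admissible : ∀ {n x} rest S {acc} → (x ∷ rest) ++ S ↭ downFrom₁ n → Tracks (suc (length rest)) acc S →
  ¬ MMPAt rest x S → Admissible (suc (length rest)) acc S x (nextEntry x rest acc)
nextEntry-admissible {x = x} rest S perm tr noMMP =
  [ admissible-small rest S perm tr noMMP , admissible-large rest S perm tr noMMP ]′ (≤⊎> x (suc (length rest)))

forward : ∀ {n} rpre S {acc} → rpre ++ S ↭ downFrom₁ n → Tracks (length rpre) acc S →
  InvTail (length rpre) acc → AvoidsPatE acc → MMPFreeAfter [] (reverse rpre ++ S) →
  InvTail 0 (phiGo rpre acc) × AvoidsPatE (phiGo rpre acc)
forward []         _ _ _ bounded avoids _ = bounded , avoids
forward (x ∷ rest) S {acc} perm tr bounded avoids free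
  with nextEntry-admissible rest S perm tr
         (free (reverse rest) x S (reverse-∷-++ x rest S) ∘ MMPAt-↭ (↭-sym (↭-reverse rest)))
... | y<p , noTwo , match rewrite phiGo-∷ x rest acc =
  forward rest (x ∷ S) (↭-trans (shift x rest S) perm) (tracks-∷ tr match) (InvTail-∷ (s≤s⁻¹ y<p) bounded)
    (AvoidsPatE-∷ noTwo avoids) (subst (MMPFreeAfter []) (reverse-∷-++ x rest S) free)

-- Every avoider of the pattern is reached

remove : ℕ → List ℕ → List ℕ
remove c = filter (λ w → ¬? (c ≟ w))

remove-↭ : ∀ {c R} → Unique R → c ∈ R → R ↭ c ∷ remove c R
remove-↭ {c} (c≢ws ∷ _) (here refl) =
  ↭-prep c (↭-reflexive (sym (trans (filter-reject (λ w → ¬? (c ≟ w)) (λ c≢c → c≢c refl))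
                                    (filter-all (λ w → ¬? (c ≟ w)) c≢ws))))
remove-↭ {c} {w ∷ _} (w≢ws ∷ ws!) (there c∈) =
  ↭-trans (↭-prep w (remove-↭ ws! c∈))
    (↭-trans (↭-swap w c ↭-refl) (↭-prep c (↭-reflexive (sym (filter-accept (λ v → ¬? (c ≟ v)) c≢w)))))
  where
  c≢w : c ≢ w
  c≢w c≡w = All.lookup w≢ws c∈ (sym c≡w)

count-above-↭∷ : ∀ {R c rest} → R ↭ c ∷ rest → count (c <?_) rest ≡ count (c <?_) R
count-above-↭∷ {c = c} R↭ = trans (sym (count-reject (c <?_) (<-irrefl refl))) (sym (count-↭ (c <?_) R↭))

≤-max : ∀ {w R} → w ∈ R → w ≤ max 0 R
≤-max {R = R} = All.lookup (xs≤max 0 R)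

max-∈ : ∀ {i w R} → w ∈ R → i < w → i < max 0 R × max 0 R ∈ R
max-∈ {i} {R = R} w∈ i<w = i<max , [ (λ max≡0 → contradiction (subst (i <_) max≡0 i<max) n≮0) , id ]′ (argmax-sel id 0 R)
  where
  i<max : i < max 0 R
  i<max = <-≤-trans i<w (≤-max w∈)

count-above-max : ∀ R → count (max 0 R <?_) R ≡ 0
count-above-max R = count-none (max 0 R <?_) {R} (λ w∈ max<w → <⇒≱ max<w (≤-max w∈))

secondMax : List ℕ → ℕ
secondMax R = max 0 (filter (_<? max 0 R) R)

secondMax-spec : ∀ {i w₁ w₂ R} → Unique R → w₁ ∈ R → w₂ ∈ R → i < w₁ → i < w₂ → w₁ ≢ w₂ →
  i < secondMax R × secondMax R ∈ R × count (secondMax R <?_) R ≡ 1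
secondMax-spec {i} {w₁} {w₂} {R} R! w₁∈ w₂∈ i<w₁ i<w₂ w₁≢w₂ = i<c , proj₁ c∈R , count-above-c
  where
  m : ℕ
  m = max 0 R
  c : ℕ
  c = secondMax R
  belowMax : ∀ {w} → w ∈ R → w ≢ m → w ∈ filter (_<? m) R
  belowMax w∈ w≢m = ∈-filter⁺ (_<? m) w∈ (≤∧≢⇒< (≤-max w∈) w≢m)
  candidate : ∃[ w ] (w ∈ filter (_<? m) R × i < w)
  candidate with w₁ ≟ m
  ... | yes w₁≡m = w₂ , belowMax w₂∈ (λ w₂≡m → w₁≢w₂ (trans w₁≡m (sym w₂≡m))) , i<w₂
  ... | no w₁≢m  = w₁ , belowMax w₁∈ w₁≢m , i<w₁
  i<c×c∈ : i < c × c ∈ filter (_<? m) R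
  i<c×c∈ = let (_ , w∈ , i<w) = candidate in max-∈ w∈ i<w
  i<c : i < c
  i<c = proj₁ i<c×c∈
  c∈R : c ∈ R × c < m
  c∈R = ∈-filter⁻ (_<? m) (proj₂ i<c×c∈)
  notAbove : ∀ {v} → v ∈ remove m R → ¬ c < v
  notAbove v∈ c<v = let (v∈R , m≢v) = ∈-filter⁻ (λ w → ¬? (m ≟ w)) v∈ in
    <⇒≱ c<v (≤-max (belowMax v∈R (m≢v ∘ sym)))
  count-above-c : count (c <?_) R ≡ 1
  count-above-c = begin
    count (c <?_) R                  ≡⟨ count-↭ (c <?_) (remove-↭ R! (proj₂ (max-∈ w₁∈ i<w₁))) ⟩
    count (c <?_) (m ∷ remove m R)   ≡⟨ count-accept (c <?_) (proj₂ c∈R) ⟩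
    suc (count (c <?_) (remove m R)) ≡⟨ cong suc (count-none (c <?_) notAbove) ⟩
    1                                ∎
    where open ≡-Reasoning

choose : ℕ → List ℕ → List ℕ → ℕ
choose y R acc with suc y ∈? R
... | yes _ = suc y
... | no _ with y ≟ kthSmallest 1 acc
...   | yes _ = max 0 R
...   | no _  = secondMax R

ChoiceShape : ℕ → List ℕ → List ℕ → List ℕ → ℕ → ℕ → Set
ChoiceShape p R S acc c y =
  c ≡ suc y ⊎ (p < c × suc y ∈ S × ∃[ k ] (k < 2 × count (c <?_) R ≡ k × y ≡ kthSmallest (suc k) acc))

shape⇒match : ∀ {p R S acc c y} → ChoiceShape p R S acc c y → EntryMatch p c y S
shape⇒match (inj₁ c≡1+y)            = inj₁ c≡1+y
shape⇒match (inj₂ (p<c , 1+y∈ , _)) = inj₂ (p<c , 1+y∈)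

module Choice {n : ℕ} (R S : List ℕ) {acc : List ℕ} {y : ℕ} (perm : R ++ S ↭ downFrom₁ n)
              (tr : Tracks (length R) acc S) (y<p : y < length R) (noTwo : ¬ TwoBelow y acc) where

  open Arrangement R S perm

  choose-largest : suc y ∈ S → y ≡ kthSmallest 1 acc → max 0 R ∈ R × ChoiceShape (length R) R S acc (max 0 R) y
  choose-largest 1+y∈S y≡k₁ =
    let (w , w∈R , p<w) = 1≤count⇒∈ (length R <?_) R (subst (1 ≤_) (sym balance) (∈⇒1≤count (_≤? length R) 1+y∈S y<p))
        (p<m , m∈R) = max-∈ w∈R p<w
    in m∈R , inj₂ (p<m , 1+y∈S , 0 , s≤s z≤n , count-above-max R , y≡k₁)

  choose-secondLargest : suc y ∈ S → y ≢ kthSmallest 1 acc →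
    secondMax R ∈ R × ChoiceShape (length R) R S acc (secondMax R) y
  choose-secondLargest 1+y∈S y≢k₁ =
    let y∈acc = proj₂ (tr y<p) 1+y∈S
        (k₁∈ , k₁≤y , _) = kthSmallest-1 y∈acc
        k₁<p = <-trans (≤∧≢⇒< k₁≤y (y≢k₁ ∘ sym)) y<p
        two = distinct⇒2≤count (_≤? length R) 1+y∈S (proj₁ (tr k₁<p) k₁∈) y<p k₁<p (y≢k₁ ∘ suc-injective)
        (w₁ , w₂ , w₁∈ , w₂∈ , p<w₁ , p<w₂ , w₁≢w₂) =
          2≤count⇒distinct (length R <?_) unique-R (subst (2 ≤_) (sym balance) two)
        (p<c , c∈R , count-above-c) = secondMax-spec unique-R w₁∈ w₂∈ p<w₁ p<w₂ w₁≢w₂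
        y≡k₂ = [ (λ y≡k₁ → contradiction y≡k₁ y≢k₁) , id ]′ (¬TwoBelow⇒kthSmallest-1∨2 y∈acc noTwo)
    in c∈R , inj₂ (p<c , 1+y∈S , 1 , s≤s (s≤s z≤n) , count-above-c , y≡k₂)

choose-spec : ∀ {n} R S {acc y} → R ++ S ↭ downFrom₁ n → Tracks (length R) acc S → y < length R →
  ¬ TwoBelow y acc → choose y R acc ∈ R × ChoiceShape (length R) R S acc (choose y R acc) y
choose-spec R S {acc} {y} perm tr y<p noTwo with suc y ∈? R
... | yes 1+y∈R = 1+y∈R , inj₁ refl
... | no 1+y∉R with y ≟ kthSmallest 1 acc
...   | yes y≡k₁ = Choice.choose-largest R S perm tr y<p noTwo (Arrangement.∉R⇒∈S R S perm y<p 1+y∉R) y≡k₁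
...   | no y≢k₁  = Choice.choose-secondLargest R S perm tr y<p noTwo (Arrangement.∉R⇒∈S R S perm y<p 1+y∉R) y≢k₁

choice-nextEntry : ∀ {R c y acc S rest} → Unique R → R ↭ c ∷ rest → y < length R →
  ChoiceShape (length R) R S acc c y → nextEntry c rest acc ≡ y
choice-nextEntry {y = y} {acc} R! R↭ y<p (inj₁ refl) = nextEntry-small acc (subst (suc y ≤_) (↭-length R↭) y<p)
choice-nextEntry {R} {c} {y} {acc} {rest = rest} R! R↭ _ (inj₂ (p<c , _ , k , _ , count-above-c , y≡kₖ)) = begin
  nextEntry c rest acc                       ≡⟨ nextEntry-large acc (subst (_< c) (↭-length R↭) p<c) (Unique-↭ R↭ R!) ⟩
  kthSmallest (suc (count (c <?_) rest)) acc ≡⟨ cong (λ j → kthSmallest (suc j) acc) (trans (count-above-↭∷ R↭) count-above-c) ⟩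
  kthSmallest (suc k) acc                    ≡⟨ y≡kₖ ⟨
  y                                          ∎
  where open ≡-Reasoning

choice-noMMP : ∀ {n} R S {acc c y rest} → R ++ S ↭ downFrom₁ n → Tracks (length R) acc S → R ↭ c ∷ rest →
  y < length R → ¬ TwoBelow y acc → ChoiceShape (length R) R S acc c y → ¬ MMPAt rest c S
choice-noMMP R S {y = y} perm tr _ y<p noTwo (inj₁ refl) (mmpAt _ after) =
  noTwo (Tracking.2≤count⇒TwoBelow R S perm tr (<⇒≤ y<p)
          (≤-trans after (count-mono (_<? suc y) (_≤? y) S (λ _ → s≤s⁻¹))))
choice-noMMP _ _ _ _ R↭ _ _ (inj₂ (_ , _ , _ , k<2 , count-above-c , _)) (mmpAt before _) =
  <⇒≱ k<2 (subst (2 ≤_) (trans (count-above-↭∷ R↭) count-above-c) before)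

phiInvGo : List ℕ → List ℕ → List ℕ → List ℕ
phiInvGo []       _ _   = []
phiInvGo (y ∷ ys) R acc = choose y R acc ∷ phiInvGo ys (remove (choose y R acc) R) (y ∷ acc)

InverseResult : List ℕ → List ℕ → List ℕ → List ℕ → Set
InverseResult rEs R S acc =
  phiInvGo rEs R acc ↭ R × phiGo (phiInvGo rEs R acc) acc ≡ reverse rEs ++ acc ×
  MMPFreeAfter [] (reverse (phiInvGo rEs R acc) ++ S)

inverse : ∀ {n} rEs R S {acc} → R ++ S ↭ downFrom₁ n → length R ≡ length rEs → Tracks (length R) acc S →
  InvTail 0 (reverse rEs ++ acc) → AvoidsPatE (reverse rEs ++ acc) → MMPFreeAfter R S → InverseResult rEs R S acc
inverse []       []      _ _ _    _ _ _ free = ↭-refl , refl , free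
inverse []       (_ ∷ _) _ _ ()
inverse (y ∷ ys) R S {acc} perm |R| tr bounded avoids free =
  ↭-trans (↭-prep c (proj₁ IH)) (↭-sym R↭) ,
  (begin
    phiGo (c ∷ rest) acc                    ≡⟨ phiGo-∷ c rest acc ⟩
    phiGo rest (nextEntry c rest acc ∷ acc) ≡⟨ cong (λ e → phiGo rest (e ∷ acc)) (choice-nextEntry unique-R R↭rest y<p shape) ⟩
    phiGo rest (y ∷ acc)                    ≡⟨ proj₁ (proj₂ IH) ⟩
    reverse ys ++ y ∷ acc                   ≡⟨ e≡ ⟨
    reverse (y ∷ ys) ++ acc                 ∎) ,
  subst (MMPFreeAfter []) (sym (reverse-∷-++ c rest S)) (proj₂ (proj₂ IH))
  where
  open ≡-Reasoning
  open Arrangement R S perm using (unique-R)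
  e≡ : reverse (y ∷ ys) ++ acc ≡ reverse ys ++ y ∷ acc
  e≡ = reverse-∷-++ y ys acc
  y<p : y < length R
  y<p = subst (y <_) (sym |R|)
          (s≤s (subst (y ≤_) (length-reverse ys) (InvTail-++⇒≤ (reverse ys) (subst (InvTail 0) e≡ bounded))))
  noTwo : ¬ TwoBelow y acc
  noTwo = AvoidsPatE⇒¬TwoBelow (reverse ys) (subst AvoidsPatE e≡ avoids)
  c : ℕ
  c = choose y R acc
  shape : ChoiceShape (length R) R S acc c y
  shape = proj₂ (choose-spec R S perm tr y<p noTwo)
  R' : List ℕ
  R' = remove c R
  R↭ : R ↭ c ∷ R'
  R↭ = remove-↭ unique-R (proj₁ (choose-spec R S perm tr y<p noTwo))
  |R|≡ : length R ≡ suc (length R')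
  |R|≡ = ↭-length R↭
  IH : InverseResult ys R' (c ∷ S) (y ∷ acc)
  IH = inverse ys R' (c ∷ S) (↭-trans (shift c R' S) (↭-trans (++⁺ʳ S (↭-sym R↭)) perm))
         (suc-injective (trans (sym |R|≡) |R|))
         (tracks-∷ (subst (λ p → Tracks p acc S) |R|≡ tr) (subst (λ p → EntryMatch p c y S) |R|≡ (shape⇒match {R = R} {acc = acc} shape)))
         (subst (InvTail 0) e≡ bounded) (subst AvoidsPatE e≡ avoids)
         (MMPFreeAfter-∷ R↭ free (choice-noMMP R S perm tr R↭ y<p noTwo shape))
  rest : List ℕ
  rest = phiInvGo ys R' (y ∷ acc)
  R↭rest : R ↭ c ∷ rest
  R↭rest = ↭-trans R↭ (↭-prep c (↭-sym (proj₁ IH)))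

phi-avoiders : ∀ {n π} → IsPerm n π → AvoidsMMP0202 π → IsInvSeq n (phi π) × AvoidsPatE (phi π)
phi-avoiders {n} {π} isPerm avoids =
  subst (λ e → IsInvSeq n e × AvoidsPatE e) (sym (phi≡phiGo π (↭downFrom₁⇒bounded perm)))
    ((length-code , proj₁ code) , proj₂ code)
  where
  perm : π ↭ downFrom₁ n
  perm = ↭-trans isPerm (upTo↭downFrom₁ n)
  code : InvTail 0 (phiGo (reverse π) []) × AvoidsPatE (phiGo (reverse π) [])
  code = forward (reverse π) [] (↭-trans (↭-reflexive (++-identityʳ _)) (↭-trans (↭-reverse π) perm))
           tracks-[] (λ ()) (λ { (() , _) })
           (subst (MMPFreeAfter []) (sym (trans (++-identityʳ _) (reverse-involutive π))) (AvoidsMMP⇒MMPFree avoids))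
  length-code : length (phiGo (reverse π) []) ≡ n
  length-code = begin
    length (phiGo (reverse π) []) ≡⟨ length-phiGo (reverse π) [] ⟩
    length (reverse π) + 0        ≡⟨ +-identityʳ _ ⟩
    length (reverse π)            ≡⟨ length-reverse π ⟩
    length π                      ≡⟨ ↭-length perm ⟩
    length (downFrom₁ n)          ≡⟨ length-downFrom₁ n ⟩
    n                             ∎
    where open ≡-Reasoning

phi-onto : ∀ {n e} → IsInvSeq n e → AvoidsPatE e → ∃[ π ] (IsPerm n π × AvoidsMMP0202 π × phi π ≡ e)
phi-onto {n} {e} (|e| , bounded) avoids =
  reverse rpre ,
  ↭-trans (↭-reverse rpre) (↭-trans (proj₁ result) (↭-sym (upTo↭downFrom₁ n))) ,
  MMPFree⇒AvoidsMMP (subst (MMPFreeAfter []) (++-identityʳ _) (proj₂ (proj₂ result))) ,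
  (begin
    phi (reverse rpre)                ≡⟨ phi≡phiGo (reverse rpre) (↭downFrom₁⇒bounded (↭-trans (↭-reverse rpre) (proj₁ result))) ⟩
    phiGo (reverse (reverse rpre)) [] ≡⟨ cong (λ l → phiGo l []) (reverse-involutive rpre) ⟩
    phiGo rpre []                     ≡⟨ proj₁ (proj₂ result) ⟩
    reverse (reverse e) ++ []         ≡⟨ e≡ ⟩
    e                                 ∎)
  where
  open ≡-Reasoning
  e≡ : reverse (reverse e) ++ [] ≡ e
  e≡ = trans (++-identityʳ _) (reverse-involutive e)
  rpre : List ℕ
  rpre = phiInvGo (reverse e) (downFrom₁ n) []
  result : InverseResult (reverse e) (downFrom₁ n) [] []
  result = inverse (reverse e) (downFrom₁ n) [] (↭-reflexive (++-identityʳ _))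
             (trans (length-downFrom₁ n) (sym (trans (length-reverse e) |e|))) tracks-[]
             (subst (InvTail 0) (sym e≡) bounded) (subst AvoidsPatE (sym e≡) avoids)
             (λ { [] _ _ () ; (_ ∷ _) _ _ () })

mainTheorem14 : (n : ℕ) →
    ((π : List ℕ) → IsPerm n π → AvoidsMMP0202 π →
      IsInvSeq n (phi π) × AvoidsPatE (phi π)) ×
    ((e : List ℕ) → IsInvSeq n e → AvoidsPatE e →
      ∃[ π ] (IsPerm n π × AvoidsMMP0202 π × phi π ≡ e))
mainTheorem14 n = (λ _ → phi-avoiders) , (λ _ → phi-onto)
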